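{- Let $n$ be an odd integer and $\mu \geq 2$. Then there does not exist a set of $\mu$ transversals of $B_n$ that intersect stably in $t$ points for any $t \in \{n-\mu+1, \ldots, n-1\}$.
   Context: Rows, columns and symbols are indexed by $\{0,\ldots,n-1\}$ and taken modulo $n$; $B_n = \{(r,c,r+c \bmod n) : r,c \in \{0,\ldots,n-1\}\}$, where a triple $(r,c,e)$ means cell $(r,c)$ contains symbol $e$. A transversal of $B_n$ is a set of $n$ triples of $B_n$ containing each row, each column and each symbol exactly once. A collection of $\mu$ transversals $T_1,\ldots,T_\mu$ intersects stably in $t$ points if, with $S=\bigcap_{i=1}^\mu T_i$, $|S|=t$ and $(T_i\cap T_j)\setminus S=\emptyset$ for all $1\le i<j\le\mu$. -}

module Defs where

open import Data.Nat using (ℕ; zero; suc; _+_; NonZero)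
open import Data.Nat.DivMod using (_mod_)
open import Data.Fin using (Fin; toℕ; _≟_)
open import Data.Bool using (Bool; true; false; _∧_; if_then_else_)
open import Data.List using (List; map; allFin)
open import Data.Nat.ListAction using (sum)
open import Data.Bool.ListAction using (and)
open import Data.Product using (_×_)
open import Relation.Nullary.Decidable using (⌊_⌋)
open import Relation.Binary.PropositionalEquality using (_≡_; _≢_)

-- The symbol in cell (r , c) of B_n : (r + c) mod n.
symbol : ∀ {n} .{{_ : NonZero n}} → Fin n → Fin n → Fin n
symbol {n} r c = (toℕ r + toℕ c) mod n

-- Each triple of B_n is determined by its cell
-- (r , c) (its symbol is forced to be r + c mod n), so a set of triples of
-- B_n is a set of cells, represented by its (Bool-valued) characteristic function.
TripleSet : ℕ → Set
TripleSet n = Fin n → Fin n → Bool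

size : ∀ {n} → TripleSet n → ℕ
size {n} T = sum (map (λ r → sum (map (λ c → if T r c then 1 else 0) (allFin n))) (allFin n))

IsTransversal : ∀ {n} .{{_ : NonZero n}} → TripleSet n → Set
IsTransversal {n} T =
  size T ≡ n
  × (∀ (r : Fin n) → size (λ r' c → T r' c ∧ ⌊ r' ≟ r ⌋) ≡ 1)
  × (∀ (c : Fin n) → size (λ r c' → T r c' ∧ ⌊ c' ≟ c ⌋) ≡ 1)
  × (∀ (e : Fin n) → size (λ r c → T r c ∧ ⌊ symbol r c ≟ e ⌋) ≡ 1)

⋂ : ∀ {n μ} → (Fin μ → TripleSet n) → TripleSet n
⋂ {n} {μ} T r c = and (map (λ i → T i r c) (allFin μ))

IntersectsStably : ∀ {n μ} → (Fin μ → TripleSet n) → ℕ → Set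
IntersectsStably {n} {μ} T t =
  size (⋂ T) ≡ t
  × (∀ (i j : Fin μ) → i ≢ j → ∀ (r c : Fin n) →
       T i r c ≡ true → T j r c ≡ true → ⋂ T r c ≡ true)

-- Since t < n, some row r misses S = ⋂ T. Each T_i meets row r in one cell (r , c_i), and the
-- columns c_i are distinct: a cell shared by T_i and T_j would lie in S. Column c_i contains
-- no cell of S, because the only cell of T_i in that column is (r , c_i). As S lies inside
-- the transversal T_0 it has at most one cell per column, so its t cells occupy at most the
-- n − μ columns other than the c_i, i.e. t + μ ≤ n.
module Submission where

open import Defs
open import Data.Nat as ℕ using (ℕ; zero; suc; _+_; _≤_; _<_; _%_; NonZero; z≤n; s≤s; z<s)
open import Data.Nat.Properties
  using ( +-0-commutativeMonoid; +-identityʳ; +-comm; +-monoʳ-≤; +-mono-≤; +-mono-<-≤; +-mono-≤-<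
        ; m≤n+m; ≤-pred; ≤-trans; ≤⇒≯; m+n≡0⇒m≡0; m+n≡0⇒n≡0; n<1⇒n≡0; module ≤-Reasoning)
import Data.Nat.ListAction as List
open import Data.Fin using (Fin; zero; suc; _≟_)
open import Data.Fin.Properties using (injective⇒≤)
open import Data.Bool using (Bool; true; false; _∧_; if_then_else_)
open import Data.Bool.Properties using (∧-identityʳ; ∧-zeroʳ)
open import Data.Bool.ListAction using (and)
open import Data.List using (List; []; _∷_; map; allFin; tabulate; filter; length; lookup)
open import Data.List.Properties using (map-tabulate)
open import Data.List.Membership.Propositional using (_∈_)
open import Data.List.Membership.Propositional.Properties using (∈-filter⁺; ∈-allFin)
open import Data.List.Relation.Unary.Any using (index)
open import Data.List.Relation.Unary.Any.Properties using (lookup-index)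
open import Data.Product using (Σ; _×_; _,_; proj₁; proj₂; ∃)
open import Function using (id; _∘_)
open import Function.Definitions using (Injective)
open import Relation.Nullary using (¬_; Dec; does; yes; no; contradiction)
open import Relation.Nullary.Decidable using (⌊_⌋; ⌊⌋-map′)
open import Relation.Binary.PropositionalEquality hiding ([_])

open import Algebra.Properties.CommutativeMonoid.Sum +-0-commutativeMonoid
  using (sum; sum-syntax; sum-cong-≗; sum-replicate-zero; ∑-comm; ∑-distrib-+)

[_] : Bool → ℕ
[ b ] = if b then 1 else 0

[]-mono : ∀ {a b} → (a ≡ true → b ≡ true) → [ a ] ≤ [ b ]
[]-mono {false} _ = z≤n
[]-mono {true} a⇒b rewrite a⇒b refl = s≤s z≤n

0<[]⇒≡true : ∀ {b} → 0 < [ b ] → b ≡ true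
0<[]⇒≡true {true} _ = refl

[]≡0⇒≡false : ∀ {b} → [ b ] ≡ 0 → b ≡ false
[]≡0⇒≡false {false} _ = refl

≤1⇒+[≟0]≡1 : ∀ {k} → k ≤ 1 → k + [ does (k ℕ.≟ 0) ] ≡ 1
≤1⇒+[≟0]≡1 {zero} _ = refl
≤1⇒+[≟0]≡1 {suc zero} _ = refl
≤1⇒+[≟0]≡1 {suc (suc _)} (s≤s ())

∧≡true⇒ : ∀ {a b} → a ∧ b ≡ true → a ≡ true × b ≡ true
∧≡true⇒ {true} b≡true = refl , b≡true

and-tabulate : ∀ {m} (g : Fin m → Bool) → and (tabulate g) ≡ true → ∀ i → g i ≡ true
and-tabulate g all zero = proj₁ (∧≡true⇒ all)
and-tabulate g all (suc i) = and-tabulate (g ∘ suc) (proj₂ (∧≡true⇒ {g zero} all)) i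

and-map-allFin : ∀ {m} (g : Fin m → Bool) → and (map g (allFin m)) ≡ true → ∀ i → g i ≡ true
and-map-allFin g all = and-tabulate g (trans (cong and (sym (map-tabulate id g))) all)

sum-tabulate : ∀ {n} (f : Fin n → ℕ) → List.sum (tabulate f) ≡ sum f
sum-tabulate {zero} f = refl
sum-tabulate {suc n} f = cong (f zero +_) (sum-tabulate (f ∘ suc))

sum-map-allFin : ∀ {n} (f : Fin n → ℕ) → List.sum (map f (allFin n)) ≡ sum f
sum-map-allFin f = trans (cong List.sum (map-tabulate id f)) (sum-tabulate f)

length-filter≡sum : ∀ {A : Set} {P : A → Set} (P? : ∀ x → Dec (P x)) (xs : List A) →
                    length (filter P? xs) ≡ List.sum (map (λ x → [ does (P? x) ]) xs)
length-filter≡sum P? [] = refl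
length-filter≡sum P? (x ∷ xs) with does (P? x)
... | true = cong suc (length-filter≡sum P? xs)
... | false = length-filter≡sum P? xs

∑-ones : ∀ n → ∑[ x < n ] 1 ≡ n
∑-ones zero = refl
∑-ones (suc n) = cong suc (∑-ones n)

∑≡0⇒≡0 : ∀ {n} (f : Fin n → ℕ) → sum f ≡ 0 → ∀ x → f x ≡ 0
∑≡0⇒≡0 f ∑≡0 zero = m+n≡0⇒m≡0 (f zero) ∑≡0
∑≡0⇒≡0 f ∑≡0 (suc x) = ∑≡0⇒≡0 (f ∘ suc) (m+n≡0⇒n≡0 (f zero) ∑≡0) x

∑<n⇒∃≡0 : ∀ {n} (f : Fin n → ℕ) → sum f < n → ∃ λ x → f x ≡ 0
∑<n⇒∃≡0 {suc n} f ∑<n with f zero in eq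
... | zero = zero , eq
... | suc k with ∑<n⇒∃≡0 (f ∘ suc) (≤-trans (s≤s (m≤n+m _ k)) (≤-pred ∑<n))
...   | x , fx≡0 = suc x , fx≡0

0<∑⇒∃0< : ∀ {n} (f : Fin n → ℕ) → 0 < sum f → ∃ λ x → 0 < f x
0<∑⇒∃0< {suc n} f 0<∑ with f zero in eq
... | suc _ = zero , subst (0 <_) (sym eq) z<s
... | zero with 0<∑⇒∃0< (f ∘ suc) 0<∑
...   | x , 0<fx = suc x , 0<fx

∑-mono-≤ : ∀ {n} {f g : Fin n → ℕ} → (∀ x → f x ≤ g x) → sum f ≤ sum g
∑-mono-≤ {zero} f≤g = z≤n
∑-mono-≤ {suc n} f≤g = +-mono-≤ (f≤g zero) (∑-mono-≤ (f≤g ∘ suc))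

∑-mono-< : ∀ {n} {f g : Fin n → ℕ} → (∀ x → f x ≤ g x) → ∀ y → f y < g y → sum f < sum g
∑-mono-< f≤g zero fy<gy = +-mono-<-≤ fy<gy (∑-mono-≤ (f≤g ∘ suc))
∑-mono-< f≤g (suc y) fy<gy = +-mono-≤-< (f≤g zero) (∑-mono-< (f≤g ∘ suc) y fy<gy)

∑-∧-≟ : ∀ {n} (f : Fin n → Bool) (x : Fin n) → ∑[ y < n ] [ f y ∧ ⌊ y ≟ x ⌋ ] ≡ [ f x ]
∑-∧-≟ {suc n} f zero = begin
  [ f zero ∧ true ] + ∑[ y < n ] [ f (suc y) ∧ false ]
    ≡⟨ cong₂ _+_ (cong [_] (∧-identityʳ (f zero)))
                 (trans (sum-cong-≗ (λ y → cong [_] (∧-zeroʳ (f (suc y))))) (sum-replicate-zero n)) ⟩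
  [ f zero ] + 0
    ≡⟨ +-identityʳ _ ⟩
  [ f zero ] ∎
  where open ≡-Reasoning
∑-∧-≟ {suc n} f (suc x) = cong₂ _+_ (cong [_] (∧-zeroʳ (f zero))) (begin
  ∑[ y < n ] [ f (suc y) ∧ ⌊ suc y ≟ suc x ⌋ ]
    ≡⟨ sum-cong-≗ (λ y → cong (λ b → [ f (suc y) ∧ b ]) (⌊⌋-map′ _ _ (y ≟ x))) ⟩ -- not definitional
  ∑[ y < n ] [ f (suc y) ∧ ⌊ y ≟ x ⌋ ]
    ≡⟨ ∑-∧-≟ (f ∘ suc) x ⟩
  [ f (suc x) ] ∎)
  where open ≡-Reasoning

zeros : ∀ {n} → (Fin n → ℕ) → List (Fin n)
zeros {n} f = filter (λ x → f x ℕ.≟ 0) (allFin n)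

∑+length-zeros≡n : ∀ {n} (f : Fin n → ℕ) → (∀ x → f x ≤ 1) → sum f + length (zeros f) ≡ n
∑+length-zeros≡n {n} f f≤1 = begin
  sum f + length (zeros f)
    ≡⟨ cong (sum f +_) (trans (length-filter≡sum (λ x → f x ℕ.≟ 0) (allFin n))
                              (sum-map-allFin (λ x → [ does (f x ℕ.≟ 0) ]))) ⟩
  sum f + ∑[ x < n ] [ does (f x ℕ.≟ 0) ]
    ≡⟨ sym (∑-distrib-+ f _) ⟩
  ∑[ x < n ] (f x + [ does (f x ℕ.≟ 0) ])
    ≡⟨ sum-cong-≗ (λ x → ≤1⇒+[≟0]≡1 (f≤1 x)) ⟩
  ∑[ x < n ] 1
    ≡⟨ ∑-ones n ⟩
  n ∎
  where open ≡-Reasoning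

injective-into-zeros⇒≤ : ∀ {k n} (f : Fin n → ℕ) (c : Fin k → Fin n) → Injective _≡_ _≡_ c →
                         (∀ i → f (c i) ≡ 0) → k ≤ length (zeros f)
injective-into-zeros⇒≤ f c c-injective fc≡0 = injective⇒≤ (c-injective ∘ lookup-position)
  where
  position : ∀ i → c i ∈ zeros f
  position i = ∈-filter⁺ (λ x → f x ℕ.≟ 0) (∈-allFin (c i)) (fc≡0 i)
  lookup-position : ∀ {i j} → index (position i) ≡ index (position j) → c i ≡ c j
  lookup-position {i} {j} eq =
    trans (lookup-index (position i)) (trans (cong (lookup (zeros f)) eq) (sym (lookup-index (position j))))

rowCount : ∀ {n} → TripleSet n → Fin n → ℕ
rowCount {n} X r = ∑[ c < n ] [ X r c ]

colCount : ∀ {n} → TripleSet n → Fin n → ℕ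
colCount {n} X c = ∑[ r < n ] [ X r c ]

size≡∑rowCount : ∀ {n} (X : TripleSet n) → size X ≡ sum (rowCount X)
size≡∑rowCount {n} X =
  trans (sum-map-allFin (λ r → List.sum (map (λ c → [ X r c ]) (allFin n))))
        (sum-cong-≗ (λ r → sum-map-allFin (λ c → [ X r c ])))

size≡∑colCount : ∀ {n} (X : TripleSet n) → size X ≡ sum (colCount X)
size≡∑colCount X = trans (size≡∑rowCount X) (∑-comm (λ r c → [ X r c ]))

size-restrictRow : ∀ {n} (X : TripleSet n) (r : Fin n) →
                   size (λ r′ c → X r′ c ∧ ⌊ r′ ≟ r ⌋) ≡ rowCount X r
size-restrictRow X r = trans (size≡∑colCount (λ r′ c → X r′ c ∧ ⌊ r′ ≟ r ⌋)) (sum-cong-≗ (λ c → ∑-∧-≟ (λ r′ → X r′ c) r))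

size-restrictCol : ∀ {n} (X : TripleSet n) (c : Fin n) →
                   size (λ r c′ → X r c′ ∧ ⌊ c′ ≟ c ⌋) ≡ colCount X c
size-restrictCol X c = trans (size≡∑rowCount (λ r c′ → X r c′ ∧ ⌊ c′ ≟ c ⌋)) (sum-cong-≗ (λ r → ∑-∧-≟ (X r) c))

module _ {n} .{{_ : NonZero n}} {X : TripleSet n} (transversal : IsTransversal X) where

  transversal-rowCount : ∀ r → rowCount X r ≡ 1
  transversal-rowCount r = trans (sym (size-restrictRow X r)) (proj₁ (proj₂ transversal) r)

  transversal-colCount : ∀ c → colCount X c ≡ 1
  transversal-colCount c = trans (sym (size-restrictCol X c)) (proj₁ (proj₂ (proj₂ transversal)) c)

module StablyIntersectingTransversals
  {n m t} .{{_ : NonZero n}} (T : Fin (suc m) → TripleSet n)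
  (transversal : ∀ i → IsTransversal (T i)) (stable : IntersectsStably T t) where

  S : TripleSet n
  S = ⋂ T

  S⊆T : ∀ i {r c} → S r c ≡ true → T i r c ≡ true
  S⊆T i {r} {c} S∋rc = and-map-allFin (λ j → T j r c) S∋rc i

  ∑rowCount-S≡t : sum (rowCount S) ≡ t
  ∑rowCount-S≡t = trans (sym (size≡∑rowCount S)) (proj₁ stable)

  ∑colCount-S≡t : sum (colCount S) ≡ t
  ∑colCount-S≡t = trans (sym (size≡∑colCount S)) (proj₁ stable)

  colCount-S≤1 : ∀ c → colCount S c ≤ 1
  colCount-S≤1 c = subst (colCount S c ≤_) (transversal-colCount (transversal zero) c)
                     (∑-mono-≤ (λ r → []-mono (S⊆T zero {r} {c})))

  emptyRow : t < n → ∃ λ r → ∀ c → S r c ≡ false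
  emptyRow t<n =
    let r , rowCount≡0 = ∑<n⇒∃≡0 (rowCount S) (subst (_< n) (sym ∑rowCount-S≡t) t<n)
    in r , λ c → []≡0⇒≡false (∑≡0⇒≡0 (λ c → [ S r c ]) rowCount≡0 c)

  module _ {r} (row-empty : ∀ c → S r c ≡ false) where

    cell : ∀ i → ∃ λ c → T i r c ≡ true
    cell i =
      let c , 0<[T] = 0<∑⇒∃0< (λ c → [ T i r c ])
                        (subst (0 <_) (sym (transversal-rowCount (transversal i) r)) z<s)
      in c , 0<[]⇒≡true 0<[T]

    column : Fin (suc m) → Fin n
    column = proj₁ ∘ cell

    column-injective : Injective _≡_ _≡_ column
    column-injective {i} {j} same-column with i ≟ j
    ... | yes i≡j = i≡j
    ... | no i≢j = contradiction (trans (sym S∋cell) (row-empty (column i))) λ ()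
      where
      S∋cell : S r (column i) ≡ true
      S∋cell = proj₂ stable i j i≢j r (column i) (proj₂ (cell i))
                 (subst (λ c → T j r c ≡ true) (sym same-column) (proj₂ (cell j)))

    colCount-S-column≡0 : ∀ i → colCount S (column i) ≡ 0
    colCount-S-column≡0 i = n<1⇒n≡0
      (subst (colCount S (column i) <_) (transversal-colCount (transversal i) (column i))
        (∑-mono-< (λ r′ → []-mono (S⊆T i {r′} {column i})) r [S]<[T]))
      where
      [S]<[T] : [ S r (column i) ] < [ T i r (column i) ]
      [S]<[T] rewrite row-empty (column i) | proj₂ (cell i) = z<s

  t+μ≤n : t < n → t + suc m ≤ n
  t+μ≤n t<n = let r , row-empty = emptyRow t<n in begin
    t + suc m
      ≤⟨ +-monoʳ-≤ t (injective-into-zeros⇒≤ (colCount S) (column row-empty)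
                       (column-injective row-empty) (colCount-S-column≡0 row-empty)) ⟩
    t + length (zeros (colCount S))
      ≡⟨ cong (_+ length (zeros (colCount S))) (sym ∑colCount-S≡t) ⟩
    sum (colCount S) + length (zeros (colCount S))
      ≡⟨ ∑+length-zeros≡n (colCount S) colCount-S≤1 ⟩
    n ∎
    where open ≤-Reasoning

lemma4 : (n μ t : ℕ) .{{_ : NonZero n}} → n % 2 ≡ 1 → 2 ≤ μ →
           n + 1 ≤ t + μ → t + 1 ≤ n →
           ¬ (Σ (Fin μ → TripleSet n) λ T →
                (∀ i → IsTransversal (T i)) × IntersectsStably T t)
lemma4 n zero t _ () _ _
lemma4 n (suc m) t _ _ n<t+μ t<n (T , transversal , stable) =
  ≤⇒≯ (t+μ≤n T transversal stable (subst (_≤ n) (+-comm t 1) t<n))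
      (subst (_≤ t + suc m) (+-comm n 1) n<t+μ)
  where open StablyIntersectingTransversals
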